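{- Let $(M,c)\in\mathrm{Col}$. Then for every $(v,v')\in\mathrm{msg}$ with $\mathrm{ind}(v)<\mathrm{ind}(v')$ we have $c(v)\neq c(v')$.
   Context: Fix a finite set $\mathcal P$ of processes, $\mathrm{Ch}=\{(p,q)\in\mathcal P^2:p\ne q\}$, $\Sigma_p=\{p!q,p?q:q\ne p\}$, $\Sigma=\bigcup_p\Sigma_p$. For a $\Sigma$-labeled poset $(V,\le,\lambda)$, $P(v)=p$ iff $\lambda(v)\in\Sigma_p$, $V_p=P^{ -1}(p)$; $(v,v')\in\mathrm{proc}$ iff $P(v)=P(v')$, $v<v'$, no node of that process strictly between; $(v,v')\in\mathrm{msg}$ iff for some $(p,q)\in\mathrm{Ch}$, $\lambda(v)=p!q$, $\lambda(v')=q?p$ and $|\{u\le v:\lambda(u)=p!q\}|=|\{u\le v':\lambda(u)=q?p\}|$. An MSC is such a structure with $\le=(\mathrm{proc}\cup\mathrm{msg})^*$, all down-sets finite, each $V_p$ linearly ordered, $|\lambda^{ -1}(p!q)|=|\lambda^{ -1}(q?p)|$ for all channels. For an MSC $M$ and $c:V\to\{0,1\}$, let $u\sim w$ iff $P(u)=P(w)$ and, for all $v$ with ($u\le v\le w$ or $w\le v\le u$) and $P(v)=P(u)$, $c(u)=c(v)=c(w)$ (maximal monochromatic intervals on a process line). $\mathrm{Col}$ is the set of all pairs $(M,c)$, $c:V\to\{0,1\}$, such that: (1) if $v$ is minimal on its process then $c(v)=1$; (2) if $(v,v')\in\mathrm{msg}$ and $w'\le v'$ with $P(w')=P(v')$,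 then there is $(u,u')\in\mathrm{msg}$ with $\lambda(u')=\lambda(v')$, $c(u)=c(u')$ and $u'\sim w'$; (3) every $\sim$-class is finite. For $v\in V_p$, $\mathrm{ind}(v)$ is the maximal number of pairwise $\sim$-inequivalent nodes $u\in V_p$ with $u\le v$. -}

module Defs where

open import Level using (0ℓ)
open import Data.Nat using (ℕ; _<_; _≤_)
open import Data.Fin using (Fin)
open import Data.Bool using (Bool; true)
open import Data.List using (List; length)
open import Data.List.Membership.Propositional using (_∈_)
open import Data.List.Relation.Unary.All using (All)
open import Data.List.Relation.Unary.Unique.Propositional using (Unique)
open import Data.List.Relation.Unary.AllPairs using (AllPairs)
open import Data.Product using (Σ; ∃; _×_; _,_)
open import Data.Sum using (_⊎_)
open import Relation.Nullary using (¬_)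
open import Relation.Binary.PropositionalEquality using (_≡_; _≢_)
open import Relation.Binary.Structures using (IsPartialOrder)
open import Relation.Binary.Construct.Closure.ReflexiveTransitive using (Star)
open import Function.Bundles using (_⇔_; _↔_)

-- Processes are Fin n (any finite set of processes, up to renaming).
-- Actions: (p ! q) is "p!q" (p sends to q), (p ¿ q) is "p?q" (p receives from q).
data Act (n : ℕ) : Set where
  _!_ : Fin n → Fin n → Act n
  _¿_ : Fin n → Fin n → Act n

actProc : ∀ {n} → Act n → Fin n
actProc (p ! q) = p
actProc (p ¿ q) = p

actPeer : ∀ {n} → Act n → Fin n
actPeer (p ! q) = q
actPeer (p ¿ q) = q

HasSize : {V : Set} → (V → Set) → ℕ → Set
HasSize {V} S k = Σ (List V) λ xs → length xs ≡ k × Unique xs × (∀ u → (u ∈ xs) ⇔ S u)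

Finite : {V : Set} → (V → Set) → Set
Finite {V} S = Σ (List V) λ xs → ∀ u → S u → u ∈ xs

record LPoset (n : ℕ) : Set₁ where
  field
    V         : Set
    _≼_       : V → V → Set
    lab       : V → Act n
    isPartialOrder : IsPartialOrder _≡_ _≼_
    -- labels lie in Σ: p!q, p?q only for q ≠ p
    lab-wf    : ∀ v → actProc (lab v) ≢ actPeer (lab v)

  P : V → Fin n
  P v = actProc (lab v)

  _≺_ : V → V → Set
  u ≺ w = u ≼ w × u ≢ w

  proc : V → V → Set
  proc v v' = P v ≡ P v' × v ≺ v' × (∀ w → P w ≡ P v → ¬ (v ≺ w × w ≺ v'))

  msg : V → V → Set
  msg v v' = Σ (Fin n) λ p → Σ (Fin n) λ q → p ≢ q ×
             lab v ≡ (p ! q) × lab v' ≡ (q ¿ p) ×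
             Σ ℕ λ k → HasSize (λ u → u ≼ v × lab u ≡ (p ! q)) k
                     × HasSize (λ u → u ≼ v' × lab u ≡ (q ¿ p)) k

  procOrMsg : V → V → Set
  procOrMsg u w = proc u w ⊎ msg u w

record IsMSC {n : ℕ} (M : LPoset n) : Set₁ where
  open LPoset M
  field
    order-generated : ∀ u w → (u ≼ w) ⇔ Star procOrMsg u w
    downsets-finite : ∀ v → Finite (λ u → u ≼ v)
    process-linear  : ∀ u w → P u ≡ P w → u ≼ w ⊎ w ≼ u
    channels-balanced : ∀ (p q : Fin n) → p ≢ q →
      Σ V (λ v → lab v ≡ (p ! q)) ↔ Σ V (λ v → lab v ≡ (q ¿ p))

record MSC (n : ℕ) : Set₁ where
  field
    poset : LPoset n
    isMSC : IsMSC poset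
  open LPoset poset public

module _ {n : ℕ} (M : MSC n) where
  open MSC M

  -- colours: false = 0, true = 1
  -- u ∼ w : same process, and everything between them on that process has the same colour
  Sim : (V → Bool) → V → V → Set
  Sim c u w = P u ≡ P w ×
    (∀ v → ((u ≼ v × v ≼ w) ⊎ (w ≼ v × v ≼ u)) → P v ≡ P u → c u ≡ c v × c v ≡ c w)

  record InCol (c : V → Bool) : Set where
    field
      minimal-one : ∀ v → (∀ u → P u ≡ P v → u ≼ v → u ≡ v) → c v ≡ true
      msg-witness : ∀ v v' w' → msg v v' → w' ≼ v' → P w' ≡ P v' →
        Σ V λ u → Σ V λ u' → msg u u' × lab u' ≡ lab v' × c u ≡ c u' × Sim c u' w'
      classes-finite : ∀ u → Finite (Sim c u)

  Below : V → V → Set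
  Below v u = P u ≡ P v × u ≼ v

  IsInd : (V → Bool) → V → ℕ → Set
  IsInd c v k =
    (Σ (List V) λ xs → length xs ≡ k × All (Below v) xs × AllPairs (λ a b → ¬ Sim c a b) xs)
    × (∀ (xs : List V) → All (Below v) xs → AllPairs (λ a b → ¬ Sim c a b) xs → length xs ≤ k)

-- Suppose c v = c v' for a message v → v'. Every node x ≤ v' on the receiving process is
-- ∼-equivalent to the receive event of some monochromatic message with the label of v', and by
-- FIFO its send event lies below v (it is v itself when the receive event lies after v').
-- Senders that are ∼-equivalent have ∼-equivalent receivers: a node z between the two receive
-- events has, by condition (2), a monochromatic witness message whose send event FIFO traps
-- between the two senders, so z carries their common colour. Hence a family of k' pairwise
-- inequivalent nodes below v' yields one of k' pairwise inequivalent nodes below v, so k' ≤ k.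
module Submission where

open import Defs
open import Data.Bool using (Bool)
import Data.Bool as Bool
open import Data.Empty using (⊥-elim)
open import Data.Fin using (Fin; zero; suc)
open import Data.Fin.Properties using (injective⇒≤)
open import Data.List using (List; []; _∷_; length; lookup)
open import Data.List.Membership.Propositional.Properties using (∈-lookup)
open import Data.List.Relation.Binary.Pointwise using (Pointwise; []; _∷_; Pointwise-length)
open import Data.List.Relation.Binary.Subset.Propositional using (_⊆_)
open import Data.List.Relation.Unary.All as All using (All; []; _∷_)
open import Data.List.Relation.Unary.Any as Any using (here; there)
open import Data.List.Relation.Unary.Any.Properties using (lookup-index)
open import Data.List.Relation.Unary.AllPairs using (AllPairs; []; _∷_)
open import Data.List.Relation.Unary.Unique.Propositional using (Unique)
open import Data.Nat using (ℕ; _≤_; _<_)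
open import Data.Nat.Properties using (<⇒≱)
open import Data.Product using (Σ; ∃; _×_; _,_; proj₁; proj₂)
open import Data.Sum using (_⊎_; inj₁; inj₂; swap)
open import Effect.Monad using (RawMonad)
open import Function.Bundles using (Equivalence)
open import Level using (0ℓ)
open import Relation.Binary.PropositionalEquality
  using (_≡_; _≢_; refl; sym; trans; cong; subst; module ≡-Reasoning)
open import Relation.Binary.Structures using (IsPartialOrder)
open import Relation.Nullary using (¬_)
open import Relation.Nullary.Decidable using (decidable-stable)
open import Relation.Nullary.Negation using (DoubleNegation; ¬¬-Monad)

open RawMonad (¬¬-Monad {0ℓ}) using (pure; _>>=_)
open Equivalence using (to; from)

lookup-injective : ∀ {A : Set} {xs : List A} → Unique xs →
  ∀ i j → lookup xs i ≡ lookup xs j → i ≡ j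
lookup-injective (_  ∷ _) zero    zero    _  = refl
lookup-injective (x∉ ∷ _) zero    (suc j) eq = ⊥-elim (All.lookup x∉ (∈-lookup j) eq)
lookup-injective (x∉ ∷ _) (suc i) zero    eq = ⊥-elim (All.lookup x∉ (∈-lookup i) (sym eq))
lookup-injective (_  ∷ u) (suc i) (suc j) eq = cong suc (lookup-injective u i j eq)

Unique-⊆⇒length≤ : ∀ {A : Set} {xs ys : List A} →
  Unique xs → xs ⊆ ys → length xs ≤ length ys
Unique-⊆⇒length≤ {xs = xs} {ys} xs! xs⊆ys = injective⇒≤ {f = position} position-injective
  where
  position : Fin (length xs) → Fin (length ys)
  position i = Any.index (xs⊆ys (∈-lookup i))

  position-injective : ∀ {i j} → position i ≡ position j → i ≡ j
  position-injective {i} {j} eq = lookup-injective xs! i j (begin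
    lookup xs i             ≡⟨ lookup-index (xs⊆ys (∈-lookup i)) ⟩
    lookup ys (position i)  ≡⟨ cong (lookup ys) eq ⟩
    lookup ys (position j)  ≡⟨ lookup-index (xs⊆ys (∈-lookup j)) ⟨
    lookup xs j             ∎)
    where open ≡-Reasoning

module _ {V : Set} {S T : V → Set} (S⊆T : ∀ {x} → S x → T x) where

  HasSize-⊆⇒≤ : ∀ {k l} → HasSize S k → HasSize T l → k ≤ l
  HasSize-⊆⇒≤ (xs , refl , xs! , ∈xs⇔S) (ys , refl , _ , ∈ys⇔T) =
    Unique-⊆⇒length≤ xs! λ {x} x∈xs → from (∈ys⇔T x) (S⊆T (to (∈xs⇔S x) x∈xs))

  HasSize-⊂⇒< : ∀ {y k l} → T y → ¬ S y → HasSize S k → HasSize T l → k < l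
  HasSize-⊂⇒< {y} Ty ¬Sy (xs , refl , xs! , ∈xs⇔S) (ys , refl , _ , ∈ys⇔T) =
    Unique-⊆⇒length≤ (y∉xs ∷ xs!) y∷xs⊆ys
    where
    y∉xs : All (λ x → ¬ y ≡ x) xs
    y∉xs = All.tabulate λ {x} x∈xs y≡x → ¬Sy (subst S (sym y≡x) (to (∈xs⇔S x) x∈xs))

    y∷xs⊆ys : y ∷ xs ⊆ ys
    y∷xs⊆ys     (here refl)  = from (∈ys⇔T y) Ty
    y∷xs⊆ys {x} (there x∈xs) = from (∈ys⇔T x) (S⊆T (to (∈xs⇔S x) x∈xs))

module _ {A B : Set} {R : A → B → Set} where

  Pointwise⇒All : ∀ {Q : B → Set} → (∀ {x y} → R x y → Q y) →
    ∀ {xs ys} → Pointwise R xs ys → All Q ys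
  Pointwise⇒All R⇒Q []       = []
  Pointwise⇒All R⇒Q (r ∷ rs) = R⇒Q r ∷ Pointwise⇒All R⇒Q rs

  AllPairs-transport : ∀ {S : A → A → Set} {T : B → B → Set} →
    (∀ {x x' y y'} → R x y → R x' y' → S x x' → T y y') →
    ∀ {xs ys} → Pointwise R xs ys → AllPairs S xs → AllPairs T ys
  AllPairs-transport {S = S} {T} transport = go
    where
    go : ∀ {xs ys} → Pointwise R xs ys → AllPairs S xs → AllPairs T ys
    go []       []         = []
    go (r ∷ rs) (Sx ∷ Sxs) = All-transport rs Sx ∷ go rs Sxs
      where
      All-transport : ∀ {xs ys} → Pointwise R xs ys → All (S _) xs → All (T _) ys
      All-transport []         []            = []
      All-transport (r' ∷ rs') (Sxx' ∷ Sxs') = transport r r' Sxx' ∷ All-transport rs' Sxs'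

  ¬¬-Pointwise-choice : ∀ {xs} → All (λ x → DoubleNegation (∃ (R x))) xs →
    DoubleNegation (∃ (Pointwise R xs))
  ¬¬-Pointwise-choice []             = pure ([] , [])
  ¬¬-Pointwise-choice (¬¬Rx ∷ ¬¬Rxs) = do
    y  , r  ← ¬¬Rx
    ys , rs ← ¬¬-Pointwise-choice ¬¬Rxs
    pure (y ∷ ys , r ∷ rs)

¿-injective : ∀ {n} {p q p' q' : Fin n} → (p ¿ q) ≡ (p' ¿ q') → p ≡ p' × q ≡ q'
¿-injective refl = refl , refl

module Messages {n : ℕ} (M : MSC n) where
  open MSC M public
  open IsMSC isMSC public
  open IsPartialOrder isPartialOrder public
    using () renaming (refl to ≼-refl; trans to ≼-trans)

  msg-sendLabel : ∀ {a a' d d'} → msg a a' → msg d d' → lab a' ≡ lab d' → lab a ≡ lab d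
  msg-sendLabel (_ , _ , _ , la , la' , _) (_ , _ , _ , ld , ld' , _) la'≡ld'
    with ¿-injective (trans (sym la') (trans la'≡ld' ld'))
  ... | refl , refl = trans la (sym ld)

  msg-sendProc : ∀ {a a' d d'} → msg a a' → msg d d' → lab a' ≡ lab d' → P a ≡ P d
  msg-sendProc ma md la'≡ld' = cong actProc (msg-sendLabel ma md la'≡ld')

  -- Only double-negated: in the case v ≼ u the counting argument merely refutes ¬ u ≼ v,
  -- and V has no decidable equality to conclude u ≡ v from it.
  fifo : ∀ {u u' v v'} → msg u u' → msg v v' → lab u' ≡ lab v' → u' ≼ v' →
    DoubleNegation (u ≼ v)
  fifo {u} {u'} {v} {v'} (_ , _ , _ , lu , lu' , _ , sends≤u , recvs≤u')
                         (_ , _ , _ , lv , lv' , _ , sends≤v , recvs≤v') lu'≡lv' u'≼v' u⋠v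
    with ¿-injective (trans (sym lu') (trans lu'≡lv' lv'))
  ... | refl , refl with process-linear u v (trans (cong actProc lu) (sym (cong actProc lv)))
  ... | inj₁ u≼v = u⋠v u≼v
  ... | inj₂ v≼u = <⇒≱ fewer-sends-below-v fewer-receives-below-u'
    where
    fewer-receives-below-u' =
      HasSize-⊆⇒≤ (λ (w≼u' , lw) → ≼-trans w≼u' u'≼v' , lw) recvs≤u' recvs≤v'
    fewer-sends-below-v =
      HasSize-⊂⇒< (λ (w≼v , lw) → ≼-trans w≼v v≼u , lw)
        (≼-refl , lu) (λ (u≼v , _) → u⋠v u≼v) sends≤v sends≤u

module Colouring {n : ℕ} (M : MSC n) (c : MSC.V M → Bool) where
  open Messages M

  _∼_ : V → V → Set
  _∼_ = Sim M c

  ∼-interval : ∀ {u w x} → u ∼ w → (u ≼ x × x ≼ w) ⊎ (w ≼ x × x ≼ u) → P x ≡ P u →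
    c x ≡ c w
  ∼-interval (_ , monochrome) between Px = proj₂ (monochrome _ between Px)

  ∼-colour : ∀ {u w} → u ∼ w → c u ≡ c w
  ∼-colour {u} {w} u∼w@(Pu , _) with process-linear u w Pu
  ... | inj₁ u≼w = ∼-interval u∼w (inj₁ (≼-refl , u≼w)) refl
  ... | inj₂ w≼u = ∼-interval u∼w (inj₂ (w≼u , ≼-refl)) refl

  ∼-sym : ∀ {u w} → u ∼ w → w ∼ u
  ∼-sym (Pu , monochrome) = sym Pu , λ x between Px →
    let cu≡cx , cx≡cw = monochrome x (swap between) (trans Px (sym Pu))
    in sym cx≡cw , sym cu≡cx

  ∼-trans : ∀ {a b d} → a ∼ b → b ∼ d → a ∼ d
  ∼-trans {a} {b} {d} a∼b@(Pa , _) b∼d@(Pb , _) = trans Pa Pb , λ x between Px →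
    let cx≡cb = colour-via-b (process-linear x b (trans Px Pa)) between Px
    in trans (∼-colour a∼b) (sym cx≡cb) , trans cx≡cb (∼-colour b∼d)
    where
    colour-via-b : ∀ {x} → x ≼ b ⊎ b ≼ x → (a ≼ x × x ≼ d) ⊎ (d ≼ x × x ≼ a) → P x ≡ P a →
      c x ≡ c b
    colour-via-b (inj₁ x≼b) (inj₁ (a≼x , _)) Px = ∼-interval a∼b (inj₁ (a≼x , x≼b)) Px
    colour-via-b (inj₂ b≼x) (inj₂ (_ , x≼a)) Px = ∼-interval a∼b (inj₂ (b≼x , x≼a)) Px
    colour-via-b (inj₁ x≼b) (inj₂ (d≼x , _)) Px =
      trans (∼-interval b∼d (inj₂ (d≼x , x≼b)) (trans Px Pa)) (sym (∼-colour b∼d))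
    colour-via-b (inj₂ b≼x) (inj₁ (_ , x≼d)) Px =
      trans (∼-interval b∼d (inj₁ (b≼x , x≼d)) (trans Px Pa)) (sym (∼-colour b∼d))

  ∼-shrink : ∀ {a b d} → a ∼ d → a ≼ b → b ≼ d → P b ≡ P a → a ∼ b
  ∼-shrink {a} {b} {d} a∼d@(_ , monochrome) a≼b b≼d Pb = sym Pb , λ x between Px →
    let ca≡cx , cx≡cd = monochrome x (widen between) Px
    in ca≡cx , trans cx≡cd (sym (∼-interval a∼d (inj₁ (a≼b , b≼d)) Pb))
    where
    widen : ∀ {x} → (a ≼ x × x ≼ b) ⊎ (b ≼ x × x ≼ a) → (a ≼ x × x ≼ d) ⊎ (d ≼ x × x ≼ a)
    widen (inj₁ (a≼x , x≼b)) = inj₁ (a≼x , ≼-trans x≼b b≼d)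
    widen (inj₂ (b≼x , x≼a)) = inj₁ (≼-trans a≼b b≼x , ≼-trans x≼a (≼-trans a≼b b≼d))

module Coloured {n : ℕ} (M : MSC n) (c : MSC.V M → Bool) (col : InCol M c) where
  open Messages M
  open Colouring M c
  open InCol col

  MonoMsg : V → V → Set
  MonoMsg u u' = msg u u' × c u ≡ c u'

  -- The witness of condition (2) for z lies between a' and d' on its process line (otherwise
  -- it forces c z = c a' directly), so by FIFO its sender lies between a and d.
  MonoMsg-interval-colour : ∀ {a a' d d' z} → MonoMsg a a' → MonoMsg d d' →
    lab a' ≡ lab d' → a ∼ d → a' ≼ z → z ≼ d' → P z ≡ P a' → c z ≡ c a'
  MonoMsg-interval-colour {a} {a'} {d} {d'} {z}
                          (ma , ca≡ca') (md , cd≡cd') la'≡ld' a∼d a'≼z z≼d' Pz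
    with msg-witness d d' z md z≼d' (trans Pz (cong actProc la'≡ld'))
  ... | s , s' , ms , ls'≡ld' , cs≡cs' , s'∼z =
    decidable-stable (c z Bool.≟ c a')
      (colour (process-linear s' a' Ps'≡Pa') (process-linear s' d' Ps'≡Pd'))
    where
    Ps'≡Pd' : P s' ≡ P d'
    Ps'≡Pd' = cong actProc ls'≡ld'

    Ps'≡Pa' : P s' ≡ P a'
    Ps'≡Pa' = trans Ps'≡Pd' (sym (cong actProc la'≡ld'))

    la'≡ls' : lab a' ≡ lab s'
    la'≡ls' = trans la'≡ld' (sym ls'≡ld')

    cd'≡ca' : c d' ≡ c a'
    cd'≡ca' = trans (sym cd≡cd') (trans (sym (∼-colour a∼d)) ca≡ca')

    colour : s' ≼ a' ⊎ a' ≼ s' → s' ≼ d' ⊎ d' ≼ s' → DoubleNegation (c z ≡ c a')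
    colour (inj₁ s'≼a') _ =
      pure (sym (∼-interval s'∼z (inj₁ (s'≼a' , a'≼z)) (sym Ps'≡Pa')))
    colour (inj₂ _) (inj₂ d'≼s') =
      pure (trans (sym (∼-interval s'∼z (inj₂ (z≼d' , d'≼s')) (sym Ps'≡Pd'))) cd'≡ca')
    colour (inj₂ a'≼s') (inj₁ s'≼d') = do
      a≼s ← fifo ma ms la'≡ls' a'≼s'
      s≼d ← fifo ms md ls'≡ld' s'≼d'
      let Ps≡Pa = sym (msg-sendProc ma ms la'≡ls')
      pure (begin
        c z  ≡⟨ ∼-colour (∼-sym s'∼z) ⟩
        c s' ≡⟨ cs≡cs' ⟨
        c s  ≡⟨ ∼-interval a∼d (inj₁ (a≼s , s≼d)) Ps≡Pa ⟩
        c d  ≡⟨ ∼-colour a∼d ⟨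
        c a  ≡⟨ ca≡ca' ⟩
        c a' ∎)
      where open ≡-Reasoning

  MonoMsg-receivers-∼ : ∀ {a a' d d'} → MonoMsg a a' → MonoMsg d d' → lab a' ≡ lab d' →
    a ∼ d → a' ∼ d'
  MonoMsg-receivers-∼ {a} {a'} {d} {d'} aa' dd' la'≡ld' a∼d =
    cong actProc la'≡ld' , λ _ between Pz → colour between Pz
    where
    ca'≡cd' : c a' ≡ c d'
    ca'≡cd' = trans (sym (proj₂ aa')) (trans (∼-colour a∼d) (proj₂ dd'))

    colour : ∀ {z} → (a' ≼ z × z ≼ d') ⊎ (d' ≼ z × z ≼ a') → P z ≡ P a' →
      c a' ≡ c z × c z ≡ c d'
    colour (inj₁ (a'≼z , z≼d')) Pz =
      let cz≡ca' = MonoMsg-interval-colour aa' dd' la'≡ld' a∼d a'≼z z≼d' Pz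
      in sym cz≡ca' , trans cz≡ca' ca'≡cd'
    colour (inj₂ (d'≼z , z≼a')) Pz =
      let cz≡cd' = MonoMsg-interval-colour dd' aa' (sym la'≡ld') (∼-sym a∼d) d'≼z z≼a'
                     (trans Pz (cong actProc la'≡ld'))
      in trans ca'≡cd' (sym cz≡cd') , cz≡cd'

  module _ {v v'} (mvv : msg v v') (cv≡cv' : c v ≡ c v') where

    SenderFor : V → V → Set
    SenderFor x u = Below M v u × Σ V λ u' → MonoMsg u u' × lab u' ≡ lab v' × u' ∼ x

    ¬¬senderFor : ∀ {x} → Below M v' x → DoubleNegation (∃ (SenderFor x))
    ¬¬senderFor {x} (Px , x≼v') with msg-witness v v' x mvv x≼v' Px
    ... | u , u' , mu , lu'≡lv' , cu≡cu' , u'∼x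
      with process-linear u' v' (cong actProc lu'≡lv')
    ... | inj₁ u'≼v' = do
      u≼v ← fifo mu mvv lu'≡lv' u'≼v'
      pure (u , (msg-sendProc mu mvv lu'≡lv' , u≼v) , u' , (mu , cu≡cu') , lu'≡lv' , u'∼x)
    ... | inj₂ v'≼u' =
      pure (v , (refl , ≼-refl) , v' , (mvv , cv≡cv') , refl ,
            ∼-sym (∼-shrink (∼-sym u'∼x) x≼v' v'≼u' (sym Px)))

    SenderFor-∼-reflect : ∀ {x y u w} → SenderFor x u → SenderFor y w → u ∼ w → x ∼ y
    SenderFor-∼-reflect (_ , u' , uu' , lu'≡lv' , u'∼x) (_ , w' , ww' , lw'≡lv' , w'∼y) u∼w =
      ∼-trans (∼-sym u'∼x) (∼-trans u'∼w' w'∼y)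
      where
      u'∼w' : u' ∼ w'
      u'∼w' = MonoMsg-receivers-∼ uu' ww' (trans lu'≡lv' (sym lw'≡lv')) u∼w

lemma3p8 : ∀ {n : ℕ} (M : MSC n) (c : MSC.V M → Bool) → InCol M c →
    ∀ v v' → MSC.msg M v v' → ∀ (k k' : ℕ) → IsInd M c v k → IsInd M c v' k' →
    k < k' → c v ≢ c v'
lemma3p8 M c col v v' mvv k k' (_ , k-maximal) ((xs , |xs|≡k' , xs≤v' , xs-apart) , _)
         k<k' cv≡cv' =
  ¬¬-Pointwise-choice (All.map (¬¬senderFor mvv cv≡cv') xs≤v') λ (ys , senders) →
    let ys≤v     = Pointwise⇒All proj₁ senders
        ys-apart = AllPairs-transport
                     (λ sx sx' x≁x' u∼u' → x≁x' (SenderFor-∼-reflect mvv cv≡cv' sx sx' u∼u'))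
                     senders xs-apart
        |ys|≡k'  = trans (sym (Pointwise-length senders)) |xs|≡k'
    in <⇒≱ k<k' (subst (_≤ k) |ys|≡k' (k-maximal ys ys≤v ys-apart))
  where open Coloured M c col
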